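{- As formal power series, $$\widetilde D(u,v,x)=\sum_{k\ge0}\frac{(uv(x^2+x))^k}{k!^2}\,\psi_{k+1}(ux)\,\psi_{k+1}(vx),$$ where $\psi_{k+1}(z)=\frac{d^k}{dz^k}\left(\frac{e^z-1}{z}\right)$.
   Context: The Delannoy polynomial $D_{a,b}(x)$ is the sum, over all lattice paths from $(0,0)$ to $(a,b)$ using steps $(0,1)$, $(1,0)$, $(1,1)$, of $x^{\text{number of steps}}$. Define $\widetilde D(u,v,x)=\sum_{a,b\ge0}\frac{D_{a,b}(x)\,u^{a+1}v^{b+1}}{(a+1)!\,(b+1)!}$. -}

module Defs where

open import Data.Nat as ℕ using (ℕ; zero; suc; _!; _≤_; _∸_)
open import Data.Nat.Properties using (_!≢0)
open import Data.Integer using (+_)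
open import Data.Rational using (ℚ; 0ℚ; 1ℚ; _+_; _*_; _-_; _/_)
open import Data.List using (List; []; _∷_; map; concatMap; filterᵇ; length)
open import Data.Bool using (Bool; true; false; _∧_; if_then_else_)
open import Function using (_∘_)

data Step : Set where
  up right diag : Step

stepX : Step → ℕ
stepX up    = 0
stepX right = 1
stepX diag  = 1

stepY : Step → ℕ
stepY up    = 1
stepY right = 0
stepY diag  = 1

endX endY : List Step → ℕ
endX []       = 0
endX (s ∷ p)  = stepX s ℕ.+ endX p
endY []       = 0
endY (s ∷ p)  = stepY s ℕ.+ endY p

seqs : ℕ → List (List Step)
seqs zero    = [] ∷ []
seqs (suc n) = concatMap (λ p → (up ∷ p) ∷ (right ∷ p) ∷ (diag ∷ p) ∷ []) (seqs n)

-- Coefficient of x^n in the Delannoy polynomial D_{a,b}(x):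
-- the number of lattice paths (0,0) → (a,b) with steps (0,1),(1,0),(1,1)
-- having exactly n steps.
delannoyCoeff : ℕ → ℕ → ℕ → ℕ
delannoyCoeff a b n =
  length (filterᵇ (λ p → (endX p ℕ.≡ᵇ a) ∧ (endY p ℕ.≡ᵇ b)) (seqs n))

sumℚ : ℕ → (ℕ → ℚ) → ℚ
sumℚ zero    f = 0ℚ
sumℚ (suc K) f = sumℚ K f + f K

sumUpTo : ℕ → (ℕ → ℚ) → ℚ
sumUpTo N = sumℚ (suc N)

fromℕ : ℕ → ℚ
fromℕ n = + n / 1

inv! : ℕ → ℚ
inv! n = (+ 1 / (n !)) {{n !≢0}}

FPS1 : Set
FPS1 = ℕ → ℚ

expS : FPS1
expS n = inv! n

oneS1 : FPS1
oneS1 zero    = 1ℚ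
oneS1 (suc _) = 0ℚ

_-₁_ : FPS1 → FPS1 → FPS1
(f -₁ g) n = f n - g n

-- division by z of a series with zero constant term
divZ : FPS1 → FPS1
divZ f n = f (suc n)

deriv : FPS1 → FPS1
deriv f n = fromℕ (suc n) * f (suc n)

iterate : ℕ → (FPS1 → FPS1) → FPS1 → FPS1
iterate zero    D f = f
iterate (suc k) D f = D (iterate k D f)

-- ψ_{k+1}(z) = d^k/dz^k ((e^z - 1)/z);  psi k = ψ_{k+1}
psi : ℕ → FPS1
psi k = iterate k deriv (divZ (expS -₁ oneS1))

-- Formal power series in u, v, x over ℚ:
-- F i j n = coefficient of u^i v^j x^n.

infixl 6 _+₃_
infixl 7 _*₃_
infixr 8 _^₃_

FPS3 : Set
FPS3 = ℕ → ℕ → ℕ → ℚ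

_+₃_ : FPS3 → FPS3 → FPS3
(F +₃ G) i j n = F i j n + G i j n

_*₃_ : FPS3 → FPS3 → FPS3
(F *₃ G) i j n =
  sumUpTo i λ i₁ → sumUpTo j λ j₁ → sumUpTo n λ n₁ →
    F i₁ j₁ n₁ * G (i ∸ i₁) (j ∸ j₁) (n ∸ n₁)

const₃ : ℚ → FPS3
const₃ c zero zero zero = c
const₃ c _    _    _    = 0ℚ

one₃ : FPS3
one₃ = const₃ 1ℚ

varU varV varX : FPS3
varU i j n = if (i ℕ.≡ᵇ 1) ∧ (j ℕ.≡ᵇ 0) ∧ (n ℕ.≡ᵇ 0) then 1ℚ else 0ℚ
varV i j n = if (i ℕ.≡ᵇ 0) ∧ (j ℕ.≡ᵇ 1) ∧ (n ℕ.≡ᵇ 0) then 1ℚ else 0ℚ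
varX i j n = if (i ℕ.≡ᵇ 0) ∧ (j ℕ.≡ᵇ 0) ∧ (n ℕ.≡ᵇ 1) then 1ℚ else 0ℚ

_^₃_ : FPS3 → ℕ → FPS3
F ^₃ zero  = one₃
F ^₃ suc k = (F ^₃ k) *₃ F

substUX : FPS1 → FPS3
substUX f i j n = if (j ℕ.≡ᵇ 0) ∧ (i ℕ.≡ᵇ n) then f i else 0ℚ

substVX : FPS1 → FPS3
substVX f i j n = if (i ℕ.≡ᵇ 0) ∧ (j ℕ.≡ᵇ n) then f j else 0ℚ

-- F is the formal (coefficientwise, discrete-topology) sum Σ_{k≥0} T k:
-- every coefficient of the partial sums is eventually constant, equal to F's.
HasSum : (ℕ → FPS3) → FPS3 → Set
HasSum T F = ∀ i j n → Σ ℕ λ K → ∀ K′ → K ≤ K′ →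
  sumℚ K′ (λ k → T k i j n) ≡ F i j n
  where
  open import Data.Product using (Σ)
  open import Relation.Binary.PropositionalEquality using (_≡_)

-- D̃(u,v,x) = Σ_{a,b≥0} D_{a,b}(x) u^{a+1} v^{b+1} / ((a+1)! (b+1)!)
Dtilde : FPS3
Dtilde (suc a) (suc b) n =
  fromℕ (delannoyCoeff a b n) * inv! (suc a) * inv! (suc b)
Dtilde _ _ _ = 0ℚ

term : ℕ → FPS3
term k =
  const₃ (inv! k * inv! k)
    *₃ ((varU *₃ varV *₃ ((varX ^₃ 2) +₃ varX)) ^₃ k)
    *₃ substUX (psi k)
    *₃ substVX (psi k)

module Submission where

-- We compare coefficients of u^{a+1} v^{b+1} xⁿ.
--  * Combinatorics.  The number N(a,b,n) of Delannoy paths to (a,b) with n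
--    steps obeys N(a+1,b+1,n+1) = N(a+1,b,n) + N(a,b+1,n) + N(a,b,n)
--    (split off the first step), and so does the closed formula
--    Σ_k C(a,k) C(b,k) [x^{n+k}] x^{a+b}(1+x)^k (Pascal's rule); hence they agree.
--  * ψ_{k+1} has the coefficients [z^m] ψ_{k+1} = k! C(k+m,k) / (k+m+1)!.
--  * A small calculus for coefficients of Cauchy products: series concentrated
--    in one (u,v)-bidegree, series vanishing below a bidegree, and convolution in
--    x of kernels x^s (1+x)^k with monomials.  It shows that the k-th summand
--    vanishes below bidegree (k,k) and that its coefficient at u^a v^b xⁿ is the
--    k-th term of the closed formula divided by (a+1)! (b+1)!.
-- Summing over k ≤ a then gives D̃ = u v · S.

open import Defs
open import Data.Nat as ℕ
  using (ℕ; zero; suc; _≤_; _<_; z≤n; s≤s; _∸_; _!)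
import Data.Nat.Properties as ℕP
import Data.Nat.Solver as ℕSolver
open import Data.Nat.Combinatorics using (_C_; nCk+nC[k+1]≡[n+1]C[k+1]; k>n⇒nCk≡0; nCk≡n!/k![n-k]!; k![n∸k]!∣n!)
open import Data.Nat.DivMod using (m/n*n≡m)
open import Data.Integer as ℤ using (+_)
import Data.Integer.Properties as ℤP
open import Data.Rational using (ℚ; 0ℚ; 1ℚ; _+_; _*_; _/_; toℚᵘ)
open import Data.Rational.Properties
import Data.Rational.Solver as ℚSolver
import Data.Rational.Unnormalised as ℚᵘ
import Data.Rational.Unnormalised.Properties as ℚᵘP
open import Data.Bool using (Bool; true; false; _∧_; if_then_else_)
open import Data.Bool.Properties using (∧-zeroʳ)
open import Data.List using (List; []; _∷_; length; filterᵇ; concatMap)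
open import Data.Product using (Σ; _×_; _,_; proj₁; proj₂)
open import Data.Sum using (_⊎_; inj₁; inj₂)
open import Data.Empty using (⊥-elim)
open import Function using (_∘_)
open import Relation.Nullary using (yes; no)
open import Relation.Binary.PropositionalEquality
open ≡-Reasoning
open import Algebra.Bundles using (CommutativeMonoid)
open import Algebra.Properties.CommutativeSemigroup ℕP.+-commutativeSemigroup
  using () renaming (interchange to ℕ-+-interchange)
open import Algebra.Properties.CommutativeSemigroup
  (CommutativeMonoid.commutativeSemigroup +-0-commutativeMonoid)
  using () renaming (interchange to ℚ-+-interchange)

toℚᵘ-fromℕ : ∀ m → toℚᵘ (fromℕ m) ℚᵘ.≃ ℚᵘ.mkℚᵘ (+ m) 0
toℚᵘ-fromℕ m = toℚᵘ-fromℚᵘ (ℚᵘ.mkℚᵘ (+ m) 0)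

fromℕ-+ : ∀ m n → fromℕ (m ℕ.+ n) ≡ fromℕ m + fromℕ n
fromℕ-+ m n = toℚᵘ-injective (ℚᵘP.≃-trans (toℚᵘ-fromℕ (m ℕ.+ n))
  (ℚᵘP.≃-trans (ℚᵘ.*≡* cross) (ℚᵘP.≃-sym (ℚᵘP.≃-trans (toℚᵘ-homo-+ (fromℕ m) (fromℕ n))
    (ℚᵘP.+-cong (toℚᵘ-fromℕ m) (toℚᵘ-fromℕ n))))))
  where
  cross : + (m ℕ.+ n) ℤ.* + 1 ≡ (+ m ℤ.* + 1 ℤ.+ + n ℤ.* + 1) ℤ.* + 1
  cross = begin
    + (m ℕ.+ n) ℤ.* + 1                        ≡⟨ ℤP.*-identityʳ _ ⟩
    + m ℤ.+ + n                                ≡⟨ cong₂ ℤ._+_ (ℤP.*-identityʳ (+ m)) (ℤP.*-identityʳ (+ n)) ⟨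
    + m ℤ.* + 1 ℤ.+ + n ℤ.* + 1                ≡⟨ ℤP.*-identityʳ _ ⟨
    (+ m ℤ.* + 1 ℤ.+ + n ℤ.* + 1) ℤ.* + 1      ∎

fromℕ-* : ∀ m n → fromℕ (m ℕ.* n) ≡ fromℕ m * fromℕ n
fromℕ-* m n = toℚᵘ-injective (ℚᵘP.≃-trans (toℚᵘ-fromℕ (m ℕ.* n))
  (ℚᵘP.≃-trans (ℚᵘ.*≡* cross) (ℚᵘP.≃-sym (ℚᵘP.≃-trans (toℚᵘ-homo-* (fromℕ m) (fromℕ n))
    (ℚᵘP.*-cong (toℚᵘ-fromℕ m) (toℚᵘ-fromℕ n))))))
  where
  cross : + (m ℕ.* n) ℤ.* + 1 ≡ (+ m ℤ.* + n) ℤ.* + 1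
  cross = trans (ℤP.*-identityʳ _) (trans (ℤP.pos-* m n) (sym (ℤP.*-identityʳ _)))

fromℕ-!-inv! : ∀ k → fromℕ (k !) * inv! k ≡ 1ℚ
fromℕ-!-inv! k with k ! | k ℕP.!≢0
... | suc d | _ = toℚᵘ-injective (ℚᵘP.≃-trans (toℚᵘ-homo-* (fromℕ (suc d)) (+ 1 / suc d))
  (ℚᵘP.≃-trans (ℚᵘP.*-cong (toℚᵘ-fromℕ (suc d)) (toℚᵘ-fromℚᵘ (ℚᵘ.mkℚᵘ (+ 1) d))) (ℚᵘ.*≡* cross)))
  where
  cross : (+ suc d ℤ.* + 1) ℤ.* + 1 ≡ + 1 ℤ.* (+ 1 ℤ.* + suc d)
  cross = trans (ℤP.*-identityʳ (+ suc d ℤ.* + 1)) (trans (ℤP.*-identityʳ (+ suc d))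
            (sym (trans (ℤP.*-identityˡ (+ 1 ℤ.* + suc d)) (ℤP.*-identityˡ (+ suc d)))))

≡ᵇ-refl : ∀ n → (n ℕ.≡ᵇ n) ≡ true
≡ᵇ-refl zero    = refl
≡ᵇ-refl (suc n) = ≡ᵇ-refl n

≢⇒≡ᵇ-false : ∀ m n → m ≢ n → (m ℕ.≡ᵇ n) ≡ false
≢⇒≡ᵇ-false zero    zero    m≢n = ⊥-elim (m≢n refl)
≢⇒≡ᵇ-false zero    (suc n) _   = refl
≢⇒≡ᵇ-false (suc m) zero    _   = refl
≢⇒≡ᵇ-false (suc m) (suc n) m≢n = ≢⇒≡ᵇ-false m n (m≢n ∘ cong suc)

sum-cong : ∀ K {f g : ℕ → ℚ} → (∀ k → k < K → f k ≡ g k) → sumℚ K f ≡ sumℚ K g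
sum-cong zero    f≡g = refl
sum-cong (suc K) f≡g = cong₂ _+_ (sum-cong K (λ k k<K → f≡g k (ℕP.m<n⇒m<1+n k<K))) (f≡g K ℕP.≤-refl)

sum-vanish : ∀ K {f : ℕ → ℚ} → (∀ k → k < K → f k ≡ 0ℚ) → sumℚ K f ≡ 0ℚ
sum-vanish K f≡0 = trans (sum-cong K f≡0) (zeros K)
  where
  zeros : ∀ K → sumℚ K (λ _ → 0ℚ) ≡ 0ℚ
  zeros zero    = refl
  zeros (suc K) = cong (_+ 0ℚ) (zeros K)

sum-single : ∀ K {f : ℕ → ℚ} p → p < K → (∀ k → k < K → k ≢ p → f k ≡ 0ℚ) → sumℚ K f ≡ f p
sum-single (suc K) {f} p p<1+K others with p ℕ.≟ K
... | yes refl = begin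
  sumℚ K f + f p  ≡⟨ cong (_+ f p) (sum-vanish K (λ k k<K → others k (ℕP.m<n⇒m<1+n k<K) (ℕP.<⇒≢ k<K))) ⟩
  0ℚ + f p        ≡⟨ +-identityˡ (f p) ⟩
  f p             ∎
... | no p≢K = begin
  sumℚ K f + f K  ≡⟨ cong₂ _+_ (sum-single K p p<K (λ k k<K → others k (ℕP.m<n⇒m<1+n k<K)))
                               (others K ℕP.≤-refl (≢-sym p≢K)) ⟩
  f p + 0ℚ        ≡⟨ +-identityʳ (f p) ⟩
  f p             ∎
  where p<K = ℕP.≤∧≢⇒< (ℕP.≤-pred p<1+K) p≢K

sum-+ : ∀ K (f g : ℕ → ℚ) → sumℚ K (λ k → f k + g k) ≡ sumℚ K f + sumℚ K g
sum-+ zero    f g = refl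
sum-+ (suc K) f g = trans (cong (_+ (f K + g K)) (sum-+ K f g)) (ℚ-+-interchange (sumℚ K f) (sumℚ K g) (f K) (g K))

sum-*ʳ : ∀ K (f : ℕ → ℚ) c → sumℚ K (λ k → f k * c) ≡ sumℚ K f * c
sum-*ʳ zero    f c = sym (*-zeroˡ c)
sum-*ʳ (suc K) f c = trans (cong (_+ (f K * c)) (sum-*ʳ K f c)) (sym (*-distribʳ-+ c (sumℚ K f) (f K)))

sum-stable : ∀ K {f : ℕ → ℚ} → (∀ k → K ≤ k → f k ≡ 0ℚ) → ∀ K′ → K ≤ K′ → sumℚ K′ f ≡ sumℚ K f
sum-stable K {f} f≡0 K′ K≤K′ with ℕP.m≤n⇒∃[o]m+o≡n K≤K′
... | o , refl = extend o
  where
  extend : ∀ o → sumℚ (K ℕ.+ o) f ≡ sumℚ K f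
  extend zero    = cong (λ L → sumℚ L _) (ℕP.+-identityʳ K)
  extend (suc o) rewrite ℕP.+-suc K o =
    trans (cong₂ _+_ (extend o) (f≡0 (K ℕ.+ o) (ℕP.m≤m+n K o))) (+-identityʳ _)

sumℕ : ℕ → (ℕ → ℕ) → ℕ
sumℕ zero    f = 0
sumℕ (suc K) f = sumℕ K f ℕ.+ f K

sumℕ-cong : ∀ K {f g : ℕ → ℕ} → (∀ k → f k ≡ g k) → sumℕ K f ≡ sumℕ K g
sumℕ-cong zero    f≡g = refl
sumℕ-cong (suc K) f≡g = cong₂ ℕ._+_ (sumℕ-cong K f≡g) (f≡g K)

sumℕ-+ : ∀ K (f g : ℕ → ℕ) → sumℕ K (λ k → f k ℕ.+ g k) ≡ sumℕ K f ℕ.+ sumℕ K g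
sumℕ-+ zero    f g = refl
sumℕ-+ (suc K) f g = trans (cong (ℕ._+ (f K ℕ.+ g K)) (sumℕ-+ K f g)) (ℕ-+-interchange (sumℕ K f) (sumℕ K g) (f K) (g K))

sumℕ-drop-last : ∀ K f → f K ≡ 0 → sumℕ (suc K) f ≡ sumℕ K f
sumℕ-drop-last K f f[K]≡0 = trans (cong (sumℕ K f ℕ.+_) f[K]≡0) (ℕP.+-identityʳ _)

sumℕ-vanish : ∀ K {f : ℕ → ℕ} → (∀ k → f k ≡ 0) → sumℕ K f ≡ 0
sumℕ-vanish zero    f≡0 = refl
sumℕ-vanish (suc K) f≡0 = cong₂ ℕ._+_ (sumℕ-vanish K f≡0) (f≡0 K)

sumℕ-first : ∀ K (f : ℕ → ℕ) → sumℕ (suc K) f ≡ f 0 ℕ.+ sumℕ K (λ k → f (suc k))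
sumℕ-first zero    f = ℕP.+-comm 0 (f 0)
sumℕ-first (suc K) f = trans (cong (ℕ._+ f (suc K)) (sumℕ-first K f)) (ℕP.+-assoc (f 0) _ _)

fromℕ-sum : ∀ K (f : ℕ → ℕ) → fromℕ (sumℕ K f) ≡ sumℚ K (λ k → fromℕ (f k))
fromℕ-sum zero    f = refl
fromℕ-sum (suc K) f = trans (fromℕ-+ (sumℕ K f) (f K)) (cong (_+ fromℕ (f K)) (fromℕ-sum K f))

-- The Delannoy recurrence for the path counts

count : (List Step → Bool) → List (List Step) → ℕ
count P ps = length (filterᵇ P ps)

indicator : Bool → ℕ
indicator b = if b then 1 else 0

count-∷ : ∀ P p ps → count P (p ∷ ps) ≡ indicator (P p) ℕ.+ count P ps
count-∷ P p ps with P p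
... | true  = refl
... | false = refl

count-none : ∀ P ps → (∀ p → P p ≡ false) → count P ps ≡ 0
count-none P []       none = refl
count-none P (p ∷ ps) none rewrite count-∷ P p ps | none p = count-none P ps none

extensions : List Step → List (List Step)
extensions p = (up ∷ p) ∷ (right ∷ p) ∷ (diag ∷ p) ∷ []

count-extensions : ∀ P ps → count P (concatMap extensions ps) ≡
  count (λ p → P (up ∷ p)) ps ℕ.+ count (λ p → P (right ∷ p)) ps ℕ.+ count (λ p → P (diag ∷ p)) ps
count-extensions P []       = refl
count-extensions P (p ∷ ps)
  rewrite count-∷ P (up ∷ p) ((right ∷ p) ∷ (diag ∷ p) ∷ concatMap extensions ps)
        | count-∷ P (right ∷ p) ((diag ∷ p) ∷ concatMap extensions ps)
        | count-∷ P (diag ∷ p) (concatMap extensions ps)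
        | count-extensions P ps
        | count-∷ (λ q → P (up ∷ q)) p ps
        | count-∷ (λ q → P (right ∷ q)) p ps
        | count-∷ (λ q → P (diag ∷ q)) p ps
  = regroup (indicator (P (up ∷ p))) (indicator (P (right ∷ p))) (indicator (P (diag ∷ p)))
            (count (λ q → P (up ∷ q)) ps) (count (λ q → P (right ∷ q)) ps) (count (λ q → P (diag ∷ q)) ps)
  where
  open ℕSolver.+-*-Solver
  regroup : ∀ a b c d e f → a ℕ.+ (b ℕ.+ (c ℕ.+ (d ℕ.+ e ℕ.+ f))) ≡ (a ℕ.+ d) ℕ.+ (b ℕ.+ e) ℕ.+ (c ℕ.+ f)
  regroup = solve 6 (λ a b c d e f → a :+ (b :+ (c :+ (d :+ e :+ f))) := (a :+ d) :+ (b :+ e) :+ (c :+ f)) refl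

endsAt : ℕ → ℕ → List Step → Bool
endsAt a b p = (endX p ℕ.≡ᵇ a) ∧ (endY p ℕ.≡ᵇ b)

-- A path with n+1 steps is a path with n steps preceded by one of the three steps.
delannoy-step : ∀ a b n → delannoyCoeff a b (suc n) ≡
  count (λ p → endsAt a b (up ∷ p)) (seqs n) ℕ.+ count (λ p → endsAt a b (right ∷ p)) (seqs n)
    ℕ.+ count (λ p → endsAt a b (diag ∷ p)) (seqs n)
delannoy-step a b n = count-extensions (endsAt a b) (seqs n)

delannoy-ss : ∀ a b n → delannoyCoeff (suc a) (suc b) (suc n) ≡
  delannoyCoeff (suc a) b n ℕ.+ delannoyCoeff a (suc b) n ℕ.+ delannoyCoeff a b n
delannoy-ss a b n = delannoy-step (suc a) (suc b) n

-- A path to (0, b+1) must start with an up step.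
delannoy-0s : ∀ b n → delannoyCoeff 0 (suc b) (suc n) ≡ delannoyCoeff 0 b n
delannoy-0s b n = trans (delannoy-step 0 (suc b) n)
  (trans (cong₂ (λ r d → delannoyCoeff 0 b n ℕ.+ r ℕ.+ d)
                (count-none _ (seqs n) (λ p → refl)) (count-none _ (seqs n) (λ p → refl)))
         (trans (ℕP.+-identityʳ _) (ℕP.+-identityʳ _)))

-- A path to (a+1, 0) must start with a right step.
delannoy-s0 : ∀ a n → delannoyCoeff (suc a) 0 (suc n) ≡ delannoyCoeff a 0 n
delannoy-s0 a n = trans (delannoy-step (suc a) 0 n)
  (trans (cong₂ (λ u d → u ℕ.+ delannoyCoeff a 0 n ℕ.+ d)
                (count-none _ (seqs n) (λ p → ∧-zeroʳ _)) (count-none _ (seqs n) (λ p → ∧-zeroʳ _)))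
         (ℕP.+-identityʳ _))

delannoy-00 : ∀ n → delannoyCoeff 0 0 (suc n) ≡ 0
delannoy-00 n = trans (delannoy-step 0 0 n)
  (cong₂ ℕ._+_ (cong₂ ℕ._+_ (count-none _ (seqs n) (λ p → ∧-zeroʳ _)) (count-none _ (seqs n) (λ p → refl)))
               (count-none _ (seqs n) (λ p → refl)))

-- A closed formula for the path counts:
--   [xⁿ] D_{a,b}(x) = Σ_{k ≤ a} C(a,k) C(b,k) [x^{n+k}] x^{a+b} (1+x)^k

-- powerCoeff k s m is the coefficient of x^m in x^s (1+x)^k.
powerCoeff : ℕ → ℕ → ℕ → ℕ
powerCoeff zero    s m = if s ℕ.≡ᵇ m then 1 else 0
powerCoeff (suc k) s m = powerCoeff k s m ℕ.+ powerCoeff k (suc s) m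

powerCoeff-shift : ∀ k s m → powerCoeff k (suc s) (suc m) ≡ powerCoeff k s m
powerCoeff-shift zero    s m = refl
powerCoeff-shift (suc k) s m = cong₂ ℕ._+_ (powerCoeff-shift k s m) (powerCoeff-shift k (suc s) m)

powerCoeff-shift+ : ∀ k s m t → powerCoeff k (s ℕ.+ t) (m ℕ.+ t) ≡ powerCoeff k s m
powerCoeff-shift+ k s m zero    = cong₂ (powerCoeff k) (ℕP.+-identityʳ s) (ℕP.+-identityʳ m)
powerCoeff-shift+ k s m (suc t) rewrite ℕP.+-suc s t | ℕP.+-suc m t =
  trans (powerCoeff-shift k (s ℕ.+ t) (m ℕ.+ t)) (powerCoeff-shift+ k s m t)

powerCoeff-below : ∀ k s m → m < s → powerCoeff k s m ≡ 0
powerCoeff-below zero    s m m<s rewrite ≢⇒≡ᵇ-false s m (≢-sym (ℕP.<⇒≢ m<s)) = refl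
powerCoeff-below (suc k) s m m<s =
  cong₂ ℕ._+_ (powerCoeff-below k s m m<s) (powerCoeff-below k (suc s) m (ℕP.m<n⇒m<1+n m<s))

delannoyTerm : ℕ → ℕ → ℕ → ℕ → ℕ
delannoyTerm a b n k = (a C k) ℕ.* (b C k) ℕ.* powerCoeff k (a ℕ.+ b) (n ℕ.+ k)

-- The closed formula truncated to k < K; the terms with k > a vanish.
delannoySum : ℕ → ℕ → ℕ → ℕ → ℕ
delannoySum K a b n = sumℕ K (delannoyTerm a b n)

delannoyClosed : ℕ → ℕ → ℕ → ℕ
delannoyClosed a = delannoySum (suc a) a

-- C(a,k-1) C(b,k-1), read as 0 for k = 0.
laggedBinoms : ℕ → ℕ → ℕ → ℕ
laggedBinoms a b zero    = 0
laggedBinoms a b (suc k) = (a C k) ℕ.* (b C k)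

binoms-pascal : ∀ a b k →
  (suc a C k) ℕ.* (suc b C k) ℕ.+ (a C k) ℕ.* (b C k) ≡
  (suc a C k) ℕ.* (b C k) ℕ.+ (a C k) ℕ.* (suc b C k) ℕ.+ laggedBinoms a b k
binoms-pascal a b zero    = refl
binoms-pascal a b (suc k) = begin
  (suc a C suc k) ℕ.* (suc b C suc k) ℕ.+ A₁ ℕ.* B₁
    ≡⟨ cong₂ (λ A B → A ℕ.* B ℕ.+ A₁ ℕ.* B₁) (sym pascalᵃ) (sym pascalᵇ) ⟩
  (A₀ ℕ.+ A₁) ℕ.* (B₀ ℕ.+ B₁) ℕ.+ A₁ ℕ.* B₁
    ≡⟨ solve 4 (λ A₀ A₁ B₀ B₁ → (A₀ :+ A₁) :* (B₀ :+ B₁) :+ A₁ :* B₁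
                  := (A₀ :+ A₁) :* B₁ :+ A₁ :* (B₀ :+ B₁) :+ A₀ :* B₀) refl A₀ A₁ B₀ B₁ ⟩
  (A₀ ℕ.+ A₁) ℕ.* B₁ ℕ.+ A₁ ℕ.* (B₀ ℕ.+ B₁) ℕ.+ A₀ ℕ.* B₀
    ≡⟨ cong₂ (λ A B → A ℕ.* B₁ ℕ.+ A₁ ℕ.* B ℕ.+ A₀ ℕ.* B₀) pascalᵃ pascalᵇ ⟩
  (suc a C suc k) ℕ.* B₁ ℕ.+ A₁ ℕ.* (suc b C suc k) ℕ.+ A₀ ℕ.* B₀  ∎
  where
  open ℕSolver.+-*-Solver
  A₀ = a C k
  A₁ = a C suc k
  B₀ = b C k
  B₁ = b C suc k
  pascalᵃ = nCk+nC[k+1]≡[n+1]C[k+1] a k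
  pascalᵇ = nCk+nC[k+1]≡[n+1]C[k+1] b k

-- The two auxiliary sums whose difference telescopes in the recurrence.
diagonalTerm laggedTerm : ℕ → ℕ → ℕ → ℕ → ℕ
diagonalTerm a b n k = (a C k) ℕ.* (b C k) ℕ.* powerCoeff k (suc (a ℕ.+ b)) (n ℕ.+ k)
laggedTerm   a b n k = laggedBinoms a b k ℕ.* powerCoeff k (suc (a ℕ.+ b)) (n ℕ.+ k)

-- Termwise form of the recurrence D(a+1,b+1,n+1) = D(a+1,b,n) + D(a,b+1,n) + D(a,b,n).
delannoyTerm-pascal : ∀ a b n k →
  delannoyTerm (suc a) (suc b) (suc n) k ℕ.+ diagonalTerm a b n k ≡
  delannoyTerm (suc a) b n k ℕ.+ delannoyTerm a (suc b) n k ℕ.+ laggedTerm a b n k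
delannoyTerm-pascal a b n k = begin
  (suc a C k) ℕ.* (suc b C k) ℕ.* powerCoeff k (suc a ℕ.+ suc b) (suc n ℕ.+ k) ℕ.+ (a C k) ℕ.* (b C k) ℕ.* E
    ≡⟨ cong (λ e → (suc a C k) ℕ.* (suc b C k) ℕ.* e ℕ.+ (a C k) ℕ.* (b C k) ℕ.* E)
            (trans (powerCoeff-shift k (a ℕ.+ suc b) (n ℕ.+ k)) a+1+b) ⟩
  (suc a C k) ℕ.* (suc b C k) ℕ.* E ℕ.+ (a C k) ℕ.* (b C k) ℕ.* E
    ≡⟨ ℕP.*-distribʳ-+ E ((suc a C k) ℕ.* (suc b C k)) ((a C k) ℕ.* (b C k)) ⟨
  ((suc a C k) ℕ.* (suc b C k) ℕ.+ (a C k) ℕ.* (b C k)) ℕ.* E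
    ≡⟨ cong (ℕ._* E) (binoms-pascal a b k) ⟩
  ((suc a C k) ℕ.* (b C k) ℕ.+ (a C k) ℕ.* (suc b C k) ℕ.+ laggedBinoms a b k) ℕ.* E
    ≡⟨ trans (ℕP.*-distribʳ-+ E (Aᵇ ℕ.+ Bᵃ) (laggedBinoms a b k))
             (cong (ℕ._+ laggedBinoms a b k ℕ.* E) (ℕP.*-distribʳ-+ E Aᵇ Bᵃ)) ⟩
  (suc a C k) ℕ.* (b C k) ℕ.* E ℕ.+ (a C k) ℕ.* (suc b C k) ℕ.* E ℕ.+ laggedBinoms a b k ℕ.* E
    ≡⟨ cong (λ e → (suc a C k) ℕ.* (b C k) ℕ.* E ℕ.+ (a C k) ℕ.* (suc b C k) ℕ.* e ℕ.+ laggedBinoms a b k ℕ.* E)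
            (sym a+1+b) ⟩
  delannoyTerm (suc a) b n k ℕ.+ delannoyTerm a (suc b) n k ℕ.+ laggedTerm a b n k  ∎
  where
  E = powerCoeff k (suc (a ℕ.+ b)) (n ℕ.+ k)
  Aᵇ = (suc a C k) ℕ.* (b C k)
  Bᵃ = (a C k) ℕ.* (suc b C k)
  a+1+b : powerCoeff k (a ℕ.+ suc b) (n ℕ.+ k) ≡ E
  a+1+b = cong (λ s → powerCoeff k s (n ℕ.+ k)) (ℕP.+-suc a b)

-- Pascal's rule for powerCoeff turns each lagged term into the previous
-- Delannoy term plus the previous diagonal term.
laggedTerm-suc : ∀ a b n k → laggedTerm a b n (suc k) ≡ delannoyTerm a b n k ℕ.+ diagonalTerm a b n k
laggedTerm-suc a b n k = begin
  (a C k) ℕ.* (b C k) ℕ.* (powerCoeff k s (n ℕ.+ suc k) ℕ.+ powerCoeff k (suc s) (n ℕ.+ suc k))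
    ≡⟨ cong (λ m → (a C k) ℕ.* (b C k) ℕ.* (powerCoeff k s m ℕ.+ powerCoeff k (suc s) m)) (ℕP.+-suc n k) ⟩
  (a C k) ℕ.* (b C k) ℕ.* (powerCoeff k s (suc (n ℕ.+ k)) ℕ.+ powerCoeff k (suc s) (suc (n ℕ.+ k)))
    ≡⟨ cong₂ (λ p q → (a C k) ℕ.* (b C k) ℕ.* (p ℕ.+ q))
             (powerCoeff-shift k (a ℕ.+ b) (n ℕ.+ k)) (powerCoeff-shift k s (n ℕ.+ k)) ⟩
  (a C k) ℕ.* (b C k) ℕ.* (powerCoeff k (a ℕ.+ b) (n ℕ.+ k) ℕ.+ powerCoeff k s (n ℕ.+ k))
    ≡⟨ ℕP.*-distribˡ-+ ((a C k) ℕ.* (b C k)) _ _ ⟩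
  delannoyTerm a b n k ℕ.+ diagonalTerm a b n k  ∎
  where s = suc (a ℕ.+ b)

delannoySum-pascal : ∀ K a b n →
  delannoySum (suc K) (suc a) (suc b) (suc n) ℕ.+ sumℕ (suc K) (diagonalTerm a b n) ≡
  delannoySum (suc K) (suc a) b n ℕ.+ delannoySum (suc K) a (suc b) n
    ℕ.+ (delannoySum K a b n ℕ.+ sumℕ K (diagonalTerm a b n))
delannoySum-pascal K a b n = begin
  delannoySum (suc K) (suc a) (suc b) (suc n) ℕ.+ sumℕ (suc K) (diagonalTerm a b n)
    ≡⟨ sumℕ-+ (suc K) _ _ ⟨
  sumℕ (suc K) (λ k → delannoyTerm (suc a) (suc b) (suc n) k ℕ.+ diagonalTerm a b n k)
    ≡⟨ sumℕ-cong (suc K) (delannoyTerm-pascal a b n) ⟩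
  sumℕ (suc K) (λ k → delannoyTerm (suc a) b n k ℕ.+ delannoyTerm a (suc b) n k ℕ.+ laggedTerm a b n k)
    ≡⟨ trans (sumℕ-+ (suc K) _ _) (cong (ℕ._+ sumℕ (suc K) (laggedTerm a b n)) (sumℕ-+ (suc K) _ _)) ⟩
  delannoySum (suc K) (suc a) b n ℕ.+ delannoySum (suc K) a (suc b) n ℕ.+ sumℕ (suc K) (laggedTerm a b n)
    ≡⟨ cong (delannoySum (suc K) (suc a) b n ℕ.+ delannoySum (suc K) a (suc b) n ℕ.+_) lagged-sum ⟩
  delannoySum (suc K) (suc a) b n ℕ.+ delannoySum (suc K) a (suc b) n
    ℕ.+ (delannoySum K a b n ℕ.+ sumℕ K (diagonalTerm a b n))  ∎
  where
  lagged-sum : sumℕ (suc K) (laggedTerm a b n) ≡ delannoySum K a b n ℕ.+ sumℕ K (diagonalTerm a b n)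
  lagged-sum = trans (sumℕ-first K (laggedTerm a b n))
                     (trans (sumℕ-cong K (laggedTerm-suc a b n)) (sumℕ-+ K _ _))

delannoyClosed-ss : ∀ a b n → delannoyClosed (suc a) (suc b) (suc n) ≡
  delannoyClosed (suc a) b n ℕ.+ delannoyClosed a (suc b) n ℕ.+ delannoyClosed a b n
delannoyClosed-ss a b n = ℕP.+-cancelʳ-≡ _ _ _ (begin
  delannoyClosed (suc a) (suc b) (suc n) ℕ.+ Δ (suc a)
    ≡⟨ cong (delannoyClosed (suc a) (suc b) (suc n) ℕ.+_) (sym (sumℕ-drop-last (suc a) _ (C[a,1+a]-factor (b C suc a) _))) ⟩
  delannoySum (suc (suc a)) (suc a) (suc b) (suc n) ℕ.+ Δ (suc (suc a))
    ≡⟨ delannoySum-pascal (suc a) a b n ⟩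
  delannoyClosed (suc a) b n ℕ.+ delannoySum (suc (suc a)) a (suc b) n ℕ.+ (delannoyClosed a b n ℕ.+ Δ (suc a))
    ≡⟨ cong (λ t → delannoyClosed (suc a) b n ℕ.+ t ℕ.+ (delannoyClosed a b n ℕ.+ Δ (suc a)))
            (sumℕ-drop-last (suc a) _ (C[a,1+a]-factor (suc b C suc a) _)) ⟩
  delannoyClosed (suc a) b n ℕ.+ delannoyClosed a (suc b) n ℕ.+ (delannoyClosed a b n ℕ.+ Δ (suc a))
    ≡⟨ ℕP.+-assoc (delannoyClosed (suc a) b n ℕ.+ delannoyClosed a (suc b) n) _ _ ⟨
  delannoyClosed (suc a) b n ℕ.+ delannoyClosed a (suc b) n ℕ.+ delannoyClosed a b n ℕ.+ Δ (suc a)  ∎)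
  where
  Δ : ℕ → ℕ
  Δ K = sumℕ K (diagonalTerm a b n)
  -- the (a+1)-st terms vanish since C(a, a+1) = 0
  C[a,1+a]-factor : ∀ x y → (a C suc a) ℕ.* x ℕ.* y ≡ 0
  C[a,1+a]-factor x y = cong (λ c → c ℕ.* x ℕ.* y) (k>n⇒nCk≡0 (ℕP.n<1+n a))

delannoyClosed-0s : ∀ b n → delannoyClosed 0 (suc b) (suc n) ≡ delannoyClosed 0 b n
delannoyClosed-0s b n = refl

delannoyClosed-00 : ∀ n → delannoyClosed 0 0 (suc n) ≡ 0
delannoyClosed-00 n = refl

-- For b = 0 only the term k = 0 survives.
delannoyClosed-a0 : ∀ a n → delannoyClosed a 0 n ≡ powerCoeff 0 (a ℕ.+ 0) (n ℕ.+ 0)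
delannoyClosed-a0 a n = begin
  delannoyClosed a 0 n
    ≡⟨ sumℕ-first a (delannoyTerm a 0 n) ⟩
  delannoyTerm a 0 n 0 ℕ.+ sumℕ a (λ k → delannoyTerm a 0 n (suc k))
    ≡⟨ cong (delannoyTerm a 0 n 0 ℕ.+_) (sumℕ-vanish a (λ k →
         cong (ℕ._* powerCoeff (suc k) (a ℕ.+ 0) (n ℕ.+ suc k)) (ℕP.*-zeroʳ (a C suc k)))) ⟩
  delannoyTerm a 0 n 0 ℕ.+ 0
    ≡⟨ ℕP.+-identityʳ _ ⟩
  1 ℕ.* powerCoeff 0 (a ℕ.+ 0) (n ℕ.+ 0)
    ≡⟨ ℕP.*-identityˡ _ ⟩
  powerCoeff 0 (a ℕ.+ 0) (n ℕ.+ 0)  ∎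

delannoyClosed-s0 : ∀ a n → delannoyClosed (suc a) 0 (suc n) ≡ delannoyClosed a 0 n
delannoyClosed-s0 a n = trans (delannoyClosed-a0 (suc a) (suc n)) (sym (delannoyClosed-a0 a n))

-- Paths with zero steps: only (a,b) = (0,0) is reached.
delannoyClosed-length0 : ∀ a b → delannoyCoeff a b 0 ≡ delannoyClosed a b 0
delannoyClosed-length0 zero    zero    = refl
delannoyClosed-length0 zero    (suc b) = refl
delannoyClosed-length0 (suc a) b       = sym (sumℕ-vanish (suc (suc a)) vanishes)
  where
  -- either C(b,k) = 0, or k ≤ b < a+1+b and the power coefficient vanishes
  vanishes : ∀ k → delannoyTerm (suc a) b 0 k ≡ 0
  vanishes k with b ℕ.<? k
  ... | yes b<k = trans (cong (λ c → (suc a C k) ℕ.* c ℕ.* powerCoeff k (suc a ℕ.+ b) k) (k>n⇒nCk≡0 b<k))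
                        (cong (ℕ._* powerCoeff k (suc a ℕ.+ b) k) (ℕP.*-zeroʳ (suc a C k)))
  ... | no  b≮k = trans (cong ((suc a C k) ℕ.* (b C k) ℕ.*_)
                         (powerCoeff-below k (suc a ℕ.+ b) k (s≤s (ℕP.≤-trans (ℕP.≮⇒≥ b≮k) (ℕP.m≤n+m b a)))))
                        (ℕP.*-zeroʳ ((suc a C k) ℕ.* (b C k)))

-- The closed formula counts Delannoy paths: both sides obey the same recurrence.
delannoy-closed : ∀ n a b → delannoyCoeff a b n ≡ delannoyClosed a b n
delannoy-closed zero    a       b       = delannoyClosed-length0 a b
delannoy-closed (suc n) zero    zero    = trans (delannoy-00 n) (sym (delannoyClosed-00 n))
delannoy-closed (suc n) zero    (suc b) =
  trans (delannoy-0s b n) (trans (delannoy-closed n zero b) (sym (delannoyClosed-0s b n)))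
delannoy-closed (suc n) (suc a) zero    =
  trans (delannoy-s0 a n) (trans (delannoy-closed n a zero) (sym (delannoyClosed-s0 a n)))
delannoy-closed (suc n) (suc a) (suc b) = begin
  delannoyCoeff (suc a) (suc b) (suc n)
    ≡⟨ delannoy-ss a b n ⟩
  delannoyCoeff (suc a) b n ℕ.+ delannoyCoeff a (suc b) n ℕ.+ delannoyCoeff a b n
    ≡⟨ cong₂ ℕ._+_ (cong₂ ℕ._+_ (delannoy-closed n (suc a) b) (delannoy-closed n a (suc b)))
                   (delannoy-closed n a b) ⟩
  delannoyClosed (suc a) b n ℕ.+ delannoyClosed a (suc b) n ℕ.+ delannoyClosed a b n
    ≡⟨ delannoyClosed-ss a b n ⟨
  delannoyClosed (suc a) (suc b) (suc n)  ∎

-- Closed form of ψ_{k+1}:  [z^m] ψ_{k+1}(z) = k! C(k+m, k) / (k+m+1)!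

rising : ℕ → ℕ → ℕ
rising m zero    = 1
rising m (suc k) = suc m ℕ.* rising (suc m) k

rising-factorial : ∀ m k → rising m k ℕ.* m ! ≡ (m ℕ.+ k) !
rising-factorial m zero    = trans (ℕP.*-identityˡ (m !)) (cong _! (sym (ℕP.+-identityʳ m)))
rising-factorial m (suc k) = begin
  suc m ℕ.* rising (suc m) k ℕ.* m !      ≡⟨ ℕP.*-assoc (suc m) (rising (suc m) k) (m !) ⟩
  suc m ℕ.* (rising (suc m) k ℕ.* m !)    ≡⟨ ℕP.*-comm (suc m) (rising (suc m) k ℕ.* m !) ⟩
  rising (suc m) k ℕ.* m ! ℕ.* suc m      ≡⟨ ℕP.*-assoc (rising (suc m) k) (m !) (suc m) ⟩
  rising (suc m) k ℕ.* (m ! ℕ.* suc m)    ≡⟨ cong (rising (suc m) k ℕ.*_) (ℕP.*-comm (m !) (suc m)) ⟩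
  rising (suc m) k ℕ.* suc m !            ≡⟨ rising-factorial (suc m) k ⟩
  (suc m ℕ.+ k) !                         ≡⟨ cong _! (ℕP.+-suc m k) ⟨
  (m ℕ.+ suc k) !                         ∎

binomial-factorials : ∀ {n k} → k ≤ n → (n C k) ℕ.* (k ! ℕ.* (n ∸ k) !) ≡ n !
binomial-factorials {n} {k} k≤n = trans (cong (ℕ._* (k ! ℕ.* (n ∸ k) !)) (nCk≡n!/k![n-k]! k≤n))
  (m/n*n≡m {{k ℕP.!* (n ∸ k) !≢0}} (k![n∸k]!∣n! k≤n))

rising-binomial : ∀ m k → rising m k ≡ k ! ℕ.* ((k ℕ.+ m) C k)
rising-binomial m k = ℕP.*-cancelʳ-≡ (rising m k) (k ! ℕ.* ((k ℕ.+ m) C k)) (m !) {{m ℕP.!≢0}} (begin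
  rising m k ℕ.* m !                        ≡⟨ rising-factorial m k ⟩
  (m ℕ.+ k) !                               ≡⟨ cong _! (ℕP.+-comm m k) ⟩
  (k ℕ.+ m) !                               ≡⟨ binomial-factorials (ℕP.m≤m+n k m) ⟨
  B ℕ.* (k ! ℕ.* (k ℕ.+ m ∸ k) !)           ≡⟨ cong (λ r → B ℕ.* (k ! ℕ.* r !)) (ℕP.m+n∸m≡n k m) ⟩
  B ℕ.* (k ! ℕ.* m !)                       ≡⟨ ℕP.*-assoc B (k !) (m !) ⟨
  B ℕ.* k ! ℕ.* m !                         ≡⟨ cong (ℕ._* m !) (ℕP.*-comm B (k !)) ⟩
  k ! ℕ.* B ℕ.* m !                         ∎)
  where B = (k ℕ.+ m) C k

-- Each derivative multiplies the m-th coefficient by m+1 and shifts it down.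
psi-rising : ∀ k m → psi k m ≡ fromℕ (rising m k) * inv! (suc (m ℕ.+ k))
psi-rising zero    m = begin
  inv! (suc m) + 0ℚ                      ≡⟨ +-identityʳ (inv! (suc m)) ⟩
  inv! (suc m)                           ≡⟨ *-identityˡ (inv! (suc m)) ⟨
  1ℚ * inv! (suc m)                      ≡⟨ cong (λ r → 1ℚ * inv! (suc r)) (ℕP.+-identityʳ m) ⟨
  1ℚ * inv! (suc (m ℕ.+ 0))              ∎
psi-rising (suc k) m = begin
  fromℕ (suc m) * psi k (suc m)
    ≡⟨ cong (fromℕ (suc m) *_) (psi-rising k (suc m)) ⟩
  fromℕ (suc m) * (fromℕ (rising (suc m) k) * inv! (suc (suc m ℕ.+ k)))
    ≡⟨ *-assoc (fromℕ (suc m)) (fromℕ (rising (suc m) k)) _ ⟨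
  fromℕ (suc m) * fromℕ (rising (suc m) k) * inv! (suc (suc m ℕ.+ k))
    ≡⟨ cong₂ _*_ (fromℕ-* (suc m) (rising (suc m) k)) (cong (λ r → inv! (suc r)) (ℕP.+-suc m k)) ⟨
  fromℕ (rising m (suc k)) * inv! (suc (m ℕ.+ suc k))  ∎

psi-closed : ∀ k m → psi k m ≡ fromℕ (k !) * fromℕ ((k ℕ.+ m) C k) * inv! (suc (k ℕ.+ m))
psi-closed k m = begin
  psi k m
    ≡⟨ psi-rising k m ⟩
  fromℕ (rising m k) * inv! (suc (m ℕ.+ k))
    ≡⟨ cong₂ (λ r s → fromℕ r * inv! (suc s)) (rising-binomial m k) (ℕP.+-comm m k) ⟩
  fromℕ (k ! ℕ.* ((k ℕ.+ m) C k)) * inv! (suc (k ℕ.+ m))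
    ≡⟨ cong (_* inv! (suc (k ℕ.+ m))) (fromℕ-* (k !) ((k ℕ.+ m) C k)) ⟩
  fromℕ (k !) * fromℕ ((k ℕ.+ m) C k) * inv! (suc (k ℕ.+ m))  ∎

-- Coefficients of Cauchy products of series in u, v, x

factorˡ-zero : ∀ {x y : ℚ} → x ≡ 0ℚ → x * y ≡ 0ℚ
factorˡ-zero {y = y} refl = *-zeroˡ y

factorʳ-zero : ∀ {x y : ℚ} → y ≡ 0ℚ → x * y ≡ 0ℚ
factorʳ-zero {x = x} refl = *-zeroʳ x

productTerm : FPS3 → FPS3 → ℕ → ℕ → ℕ → ℕ → ℕ → ℕ → ℚ
productTerm F G i j n i₁ j₁ n₁ = F i₁ j₁ n₁ * G (i ∸ i₁) (j ∸ j₁) (n ∸ n₁)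

product-vanish : ∀ F G i j n →
  (∀ i₁ j₁ n₁ → i₁ ≤ i → j₁ ≤ j → productTerm F G i j n i₁ j₁ n₁ ≡ 0ℚ) → (F *₃ G) i j n ≡ 0ℚ
product-vanish F G i j n zeroTerm =
  sum-vanish (suc i) λ i₁ i₁≤i → sum-vanish (suc j) λ j₁ j₁≤j → sum-vanish (suc n) λ n₁ _ →
    zeroTerm i₁ j₁ n₁ (ℕP.≤-pred i₁≤i) (ℕP.≤-pred j₁≤j)

product-single : ∀ F G i j n p q → p ≤ i → q ≤ j →
  (∀ i₁ j₁ n₁ → i₁ ≤ i → j₁ ≤ j → (i₁ ≢ p ⊎ j₁ ≢ q) → productTerm F G i j n i₁ j₁ n₁ ≡ 0ℚ) →
  (F *₃ G) i j n ≡ sumUpTo n (productTerm F G i j n p q)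
product-single F G i j n p q p≤i q≤j zeroTerm =
  trans (sum-single (suc i) p (s≤s p≤i) λ i₁ i₁≤i i₁≢p →
           sum-vanish (suc j) λ j₁ j₁≤j → sum-vanish (suc n) λ n₁ _ →
             zeroTerm i₁ j₁ n₁ (ℕP.≤-pred i₁≤i) (ℕP.≤-pred j₁≤j) (inj₁ i₁≢p))
        (sum-single (suc j) q (s≤s q≤j) λ j₁ j₁≤j j₁≢q →
           sum-vanish (suc n) λ n₁ _ →
             zeroTerm p j₁ n₁ p≤i (ℕP.≤-pred j₁≤j) (inj₂ j₁≢q))

Concentrated : ℕ → ℕ → FPS3 → Set
Concentrated p q F = ∀ i j n → (i ≢ p ⊎ j ≢ q) → F i j n ≡ 0ℚ

VanishesBelow : ℕ → ℕ → FPS3 → Set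
VanishesBelow p q F = ∀ i j n → (i < p ⊎ j < q) → F i j n ≡ 0ℚ

concentrated⇒vanishesBelow : ∀ {p q F} → Concentrated p q F → VanishesBelow p q F
concentrated⇒vanishesBelow F-conc i j n (inj₁ i<p) = F-conc i j n (inj₁ (ℕP.<⇒≢ i<p))
concentrated⇒vanishesBelow F-conc i j n (inj₂ j<q) = F-conc i j n (inj₂ (ℕP.<⇒≢ j<q))

-- Multiplication can only raise degrees.
*-vanishesBelow : ∀ {p q F} G → VanishesBelow p q F → VanishesBelow p q (F *₃ G)
*-vanishesBelow {p} {q} {F} G F-below i j n below =
  product-vanish F G i j n λ i₁ j₁ n₁ i₁≤i j₁≤j →
    factorˡ-zero (F-below i₁ j₁ n₁ (lower below i₁≤i j₁≤j))
  where
  lower : ∀ {i₁ j₁} → (i < p ⊎ j < q) → i₁ ≤ i → j₁ ≤ j → (i₁ < p ⊎ j₁ < q)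
  lower (inj₁ i<p) i₁≤i _ = inj₁ (ℕP.≤-<-trans i₁≤i i<p)
  lower (inj₂ j<q) _ j₁≤j = inj₂ (ℕP.≤-<-trans j₁≤j j<q)

*-at : ∀ {p q F} G → Concentrated p q F → ∀ i j n →
  (F *₃ G) (p ℕ.+ i) (q ℕ.+ j) n ≡ sumUpTo n (λ n₁ → F p q n₁ * G i j (n ∸ n₁))
*-at {p} {q} {F} G F-conc i j n = begin
  (F *₃ G) (p ℕ.+ i) (q ℕ.+ j) n
    ≡⟨ product-single F G (p ℕ.+ i) (q ℕ.+ j) n p q (ℕP.m≤m+n p i) (ℕP.m≤m+n q j)
         (λ i₁ j₁ n₁ _ _ off → factorˡ-zero (F-conc i₁ j₁ n₁ off)) ⟩
  sumUpTo n (λ n₁ → F p q n₁ * G (p ℕ.+ i ∸ p) (q ℕ.+ j ∸ q) (n ∸ n₁))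
    ≡⟨ cong₂ (λ i′ j′ → sumUpTo n (λ n₁ → F p q n₁ * G i′ j′ (n ∸ n₁))) (ℕP.m+n∸m≡n p i) (ℕP.m+n∸m≡n q j) ⟩
  sumUpTo n (λ n₁ → F p q n₁ * G i j (n ∸ n₁))  ∎

*-concentrated : ∀ {p q r s F G} → Concentrated p q F → Concentrated r s G →
  Concentrated (p ℕ.+ r) (q ℕ.+ s) (F *₃ G)
*-concentrated {p} {q} {r} {s} {F} {G} F-conc G-conc i j n off
  with p ℕ.≤? i | q ℕ.≤? j
... | no p≰i | _      = *-vanishesBelow G (concentrated⇒vanishesBelow F-conc) i j n (inj₁ (ℕP.≰⇒> p≰i))
... | yes _  | no q≰j = *-vanishesBelow G (concentrated⇒vanishesBelow F-conc) i j n (inj₂ (ℕP.≰⇒> q≰j))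
... | yes p≤i | yes q≤j with ℕP.m≤n⇒∃[o]m+o≡n p≤i | ℕP.m≤n⇒∃[o]m+o≡n q≤j
...   | i′ , refl | j′ , refl = trans (*-at G F-conc i′ j′ n)
  (sum-vanish (suc n) λ n₁ _ → factorʳ-zero {F p q n₁} (G-conc i′ j′ (n ∸ n₁) (shifted off)))
  where
  shifted : (p ℕ.+ i′ ≢ p ℕ.+ r ⊎ q ℕ.+ j′ ≢ q ℕ.+ s) → (i′ ≢ r ⊎ j′ ≢ s)
  shifted (inj₁ ne) = inj₁ (ne ∘ cong (p ℕ.+_))
  shifted (inj₂ ne) = inj₂ (ne ∘ cong (q ℕ.+_))

agree-above : ∀ {k} (F G : FPS3) → VanishesBelow k k F → VanishesBelow k k G →
  (∀ a b n → F (k ℕ.+ a) (k ℕ.+ b) n ≡ G (k ℕ.+ a) (k ℕ.+ b) n) → ∀ i j n → F i j n ≡ G i j n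
agree-above {k} F G F-below G-below agree i j n with k ℕ.≤? i | k ℕ.≤? j
... | no k≰i | _      = trans (F-below i j n (inj₁ (ℕP.≰⇒> k≰i))) (sym (G-below i j n (inj₁ (ℕP.≰⇒> k≰i))))
... | yes _  | no k≰j = trans (F-below i j n (inj₂ (ℕP.≰⇒> k≰j))) (sym (G-below i j n (inj₂ (ℕP.≰⇒> k≰j))))
... | yes k≤i | yes k≤j with ℕP.m≤n⇒∃[o]m+o≡n k≤i | ℕP.m≤n⇒∃[o]m+o≡n k≤j
...   | a , refl | b , refl = agree a b n

*-offV : ∀ {p q F G} → Concentrated p q F → (∀ i j n → j ≢ 0 → G i j n ≡ 0ℚ) →
  ∀ i j n → j ≢ q → (F *₃ G) i j n ≡ 0ℚ
*-offV {q = q} {F} {G} F-conc G-offV i j n j≢q = product-vanish F G i j n zeroTerm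
  where
  zeroTerm : ∀ i₁ j₁ n₁ → i₁ ≤ i → j₁ ≤ j → productTerm F G i j n i₁ j₁ n₁ ≡ 0ℚ
  zeroTerm i₁ j₁ n₁ _ j₁≤j with j₁ ℕ.≟ q
  ... | yes refl = factorʳ-zero {F i₁ j₁ n₁}
                     (G-offV (i ∸ i₁) (j ∸ j₁) (n ∸ n₁) (λ eq → j≢q (ℕP.≤-antisym (ℕP.m∸n≡0⇒m≤n eq) j₁≤j)))
  ... | no j₁≢q  = factorˡ-zero (F-conc i₁ j₁ n₁ (inj₂ j₁≢q))

*-atʳ : ∀ {q F G} → (∀ i j n → j ≢ q → F i j n ≡ 0ℚ) → (∀ i j n → i ≢ 0 → G i j n ≡ 0ℚ) →
  ∀ i j n → (F *₃ G) i (q ℕ.+ j) n ≡ sumUpTo n (λ n₁ → F i q n₁ * G 0 j (n ∸ n₁))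
*-atʳ {q} {F} {G} F-conc G-conc i j n = begin
  (F *₃ G) i (q ℕ.+ j) n
    ≡⟨ product-single F G i (q ℕ.+ j) n i q ℕP.≤-refl (ℕP.m≤m+n q j) zeroTerm ⟩
  sumUpTo n (λ n₁ → F i q n₁ * G (i ∸ i) (q ℕ.+ j ∸ q) (n ∸ n₁))
    ≡⟨ cong₂ (λ i′ j′ → sumUpTo n (λ n₁ → F i q n₁ * G i′ j′ (n ∸ n₁))) (ℕP.n∸n≡0 i) (ℕP.m+n∸m≡n q j) ⟩
  sumUpTo n (λ n₁ → F i q n₁ * G 0 j (n ∸ n₁))  ∎
  where
  zeroTerm : ∀ i₁ j₁ n₁ → i₁ ≤ i → j₁ ≤ q ℕ.+ j → (i₁ ≢ i ⊎ j₁ ≢ q) →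
             productTerm F G i (q ℕ.+ j) n i₁ j₁ n₁ ≡ 0ℚ
  zeroTerm i₁ j₁ n₁ i₁≤i _ (inj₁ i₁≢i) =
    factorʳ-zero {F i₁ j₁ n₁} (G-conc (i ∸ i₁) (q ℕ.+ j ∸ j₁) (n ∸ n₁) i∸i₁≢0)
    where i∸i₁≢0 = λ eq → i₁≢i (ℕP.≤-antisym i₁≤i (ℕP.m∸n≡0⇒m≤n eq))
  zeroTerm i₁ j₁ n₁ _ _ (inj₂ j₁≢q) = factorˡ-zero (F-conc i₁ j₁ n₁ j₁≢q)

IsMonomial : ℕ → ℚ → (ℕ → ℚ) → Set
IsMonomial d v h = h d ≡ v × (∀ m → m ≢ d → h m ≡ 0ℚ)

-- A family of series in x with K s = x^s · K 0, such as x^s (1+x)^k.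
record ShiftKernel (K : ℕ → ℕ → ℚ) : Set where
  field
    shift : ∀ s m → K (suc s) (suc m) ≡ K s m
    below : ∀ s m → m < s → K s m ≡ 0ℚ

  shift+ : ∀ s m t → K (s ℕ.+ t) (m ℕ.+ t) ≡ K s m
  shift+ s m zero    = cong₂ K (ℕP.+-identityʳ s) (ℕP.+-identityʳ m)
  shift+ s m (suc t) rewrite ℕP.+-suc s t | ℕP.+-suc m t = trans (shift (s ℕ.+ t) (m ℕ.+ t)) (shift+ s m t)

scaleˡ : ∀ {K} → ShiftKernel K → ∀ w → ShiftKernel (λ s m → w * K s m)
scaleˡ K-kernel w = record
  { shift = λ s m → cong (w *_) (shift s m)
  ; below = λ s m m<s → factorʳ-zero {w} (below s m m<s) }
  where open ShiftKernel K-kernel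

scaleʳ : ∀ {K} → ShiftKernel K → ∀ w → ShiftKernel (λ s m → K s m * w)
scaleʳ K-kernel w = record
  { shift = λ s m → cong (_* w) (shift s m)
  ; below = λ s m m<s → factorˡ-zero (below s m m<s) }
  where open ShiftKernel K-kernel

kernel-conv : ∀ {K d v h} → ShiftKernel K → IsMonomial d v h → ∀ s n →
  sumUpTo n (λ n₁ → K s n₁ * h (n ∸ n₁)) ≡ K (s ℕ.+ d) n * v
kernel-conv {K} {d} {v} {h} K-kernel (h[d] , h-off) s n with d ℕ.≤? n
... | yes d≤n = begin
  sumUpTo n (λ n₁ → K s n₁ * h (n ∸ n₁))
    ≡⟨ sum-single (suc n) (n ∸ d) (s≤s (ℕP.m∸n≤m n d)) off ⟩
  K s (n ∸ d) * h (n ∸ (n ∸ d))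
    ≡⟨ cong₂ _*_ (sym (shift+ s (n ∸ d) d)) (cong h (ℕP.m∸[m∸n]≡n d≤n)) ⟩
  K (s ℕ.+ d) (n ∸ d ℕ.+ d) * h d
    ≡⟨ cong₂ (λ m w → K (s ℕ.+ d) m * w) (ℕP.m∸n+n≡m d≤n) h[d] ⟩
  K (s ℕ.+ d) n * v  ∎
  where
  open ShiftKernel K-kernel
  off : ∀ n₁ → n₁ < suc n → n₁ ≢ n ∸ d → K s n₁ * h (n ∸ n₁) ≡ 0ℚ
  off n₁ n₁≤n n₁≢ = factorʳ-zero {K s n₁} (h-off (n ∸ n₁) λ eq →
    n₁≢ (trans (sym (ℕP.m∸[m∸n]≡n (ℕP.≤-pred n₁≤n))) (cong (n ∸_) eq)))
... | no d≰n = begin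
  sumUpTo n (λ n₁ → K s n₁ * h (n ∸ n₁))
    ≡⟨ sum-vanish (suc n) (λ n₁ _ → factorʳ-zero {K s n₁} (h-off (n ∸ n₁) λ eq →
                              d≰n (subst (_≤ n) eq (ℕP.m∸n≤m n n₁)))) ⟩
  0ℚ
    ≡⟨ factorˡ-zero (below (s ℕ.+ d) n (ℕP.<-≤-trans (ℕP.≰⇒> d≰n) (ℕP.m≤n+m d s))) ⟨
  K (s ℕ.+ d) n * v  ∎
  where open ShiftKernel K-kernel

monomial0-conv : ∀ {v h} → IsMonomial 0 v h → ∀ (g : ℕ → ℚ) n →
  sumUpTo n (λ n₁ → h n₁ * g (n ∸ n₁)) ≡ v * g n
monomial0-conv (h[0] , h-off) g n =
  trans (sum-single (suc n) 0 (s≤s z≤n) (λ n₁ _ n₁≢0 → factorˡ-zero (h-off n₁ n₁≢0)))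
        (cong (_* g n) h[0])

powerCoeffℚ : ℕ → ℕ → ℕ → ℚ
powerCoeffℚ k s m = fromℕ (powerCoeff k s m)

powerCoeff-kernel : ∀ k → ShiftKernel (powerCoeffℚ k)
powerCoeff-kernel k = record
  { shift = λ s m → cong fromℕ (powerCoeff-shift k s m)
  ; below = λ s m m<s → cong fromℕ (powerCoeff-below k s m m<s) }

powerCoeff0-monomial : ∀ t → IsMonomial t 1ℚ (powerCoeffℚ 0 t)
powerCoeff0-monomial t = value , off
  where
  value : powerCoeffℚ 0 t t ≡ 1ℚ
  value rewrite ≡ᵇ-refl t = refl
  off : ∀ m → m ≢ t → powerCoeffℚ 0 t m ≡ 0ℚ
  off m m≢t rewrite ≢⇒≡ᵇ-false t m (≢-sym m≢t) = refl

powerCoeff-conv : ∀ k l s t n →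
  sumUpTo n (λ n₁ → powerCoeffℚ k s n₁ * powerCoeffℚ l t (n ∸ n₁)) ≡ powerCoeffℚ (k ℕ.+ l) (s ℕ.+ t) n
powerCoeff-conv k zero s t n = begin
  sumUpTo n (λ n₁ → powerCoeffℚ k s n₁ * powerCoeffℚ 0 t (n ∸ n₁))
    ≡⟨ kernel-conv (powerCoeff-kernel k) (powerCoeff0-monomial t) s n ⟩
  powerCoeffℚ k (s ℕ.+ t) n * 1ℚ
    ≡⟨ trans (*-identityʳ _) (cong (λ k′ → powerCoeffℚ k′ (s ℕ.+ t) n) (sym (ℕP.+-identityʳ k))) ⟩
  powerCoeffℚ (k ℕ.+ 0) (s ℕ.+ t) n  ∎
powerCoeff-conv k (suc l) s t n = begin
  sumUpTo n (λ n₁ → powerCoeffℚ k s n₁ * powerCoeffℚ (suc l) t (n ∸ n₁))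
    ≡⟨ sum-cong (suc n) (λ n₁ _ → trans (cong (powerCoeffℚ k s n₁ *_) (fromℕ-+ (P t (n ∸ n₁)) (P (suc t) (n ∸ n₁))))
                                         (*-distribˡ-+ (powerCoeffℚ k s n₁) _ _)) ⟩
  sumUpTo n (λ n₁ → f t n₁ + f (suc t) n₁)
    ≡⟨ sum-+ (suc n) (f t) (f (suc t)) ⟩
  sumUpTo n (f t) + sumUpTo n (f (suc t))
    ≡⟨ cong₂ _+_ (powerCoeff-conv k l s t n) (powerCoeff-conv k l s (suc t) n) ⟩
  powerCoeffℚ (k ℕ.+ l) (s ℕ.+ t) n + powerCoeffℚ (k ℕ.+ l) (s ℕ.+ suc t) n
    ≡⟨ cong (λ s′ → powerCoeffℚ (k ℕ.+ l) (s ℕ.+ t) n + powerCoeffℚ (k ℕ.+ l) s′ n) (ℕP.+-suc s t) ⟩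
  powerCoeffℚ (k ℕ.+ l) (s ℕ.+ t) n + powerCoeffℚ (k ℕ.+ l) (suc (s ℕ.+ t)) n
    ≡⟨ fromℕ-+ (powerCoeff (k ℕ.+ l) (s ℕ.+ t) n) (powerCoeff (k ℕ.+ l) (suc (s ℕ.+ t)) n) ⟨
  powerCoeffℚ (suc (k ℕ.+ l)) (s ℕ.+ t) n
    ≡⟨ cong (λ k′ → powerCoeffℚ k′ (s ℕ.+ t) n) (ℕP.+-suc k l) ⟨
  powerCoeffℚ (k ℕ.+ suc l) (s ℕ.+ t) n  ∎
  where
  P = powerCoeff l
  f : ℕ → ℕ → ℚ
  f t′ n₁ = powerCoeffℚ k s n₁ * powerCoeffℚ l t′ (n ∸ n₁)

const-concentrated : ∀ c → Concentrated 0 0 (const₃ c)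
const-concentrated c zero    zero    n (inj₁ 0≢0) = ⊥-elim (0≢0 refl)
const-concentrated c zero    zero    n (inj₂ 0≢0) = ⊥-elim (0≢0 refl)
const-concentrated c zero    (suc j) n _          = refl
const-concentrated c (suc i) j       n _          = refl

const-monomial : ∀ c → IsMonomial 0 c (const₃ c 0 0)
const-monomial c = refl , λ { zero 0≢0 → ⊥-elim (0≢0 refl) ; (suc m) _ → refl }

const-* : ∀ c G i j n → (const₃ c *₃ G) i j n ≡ c * G i j n
const-* c G i j n = trans (*-at G (const-concentrated c) i j n) (monomial0-conv (const-monomial c) (G i j) n)

UV : FPS3
UV = varU *₃ varV

varU-concentrated : Concentrated 1 0 varU
varU-concentrated (suc zero) zero    n (inj₁ 1≢1) = ⊥-elim (1≢1 refl)
varU-concentrated (suc zero) zero    n (inj₂ 0≢0) = ⊥-elim (0≢0 refl)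
varU-concentrated zero          j       n _ = refl
varU-concentrated (suc (suc i)) j       n _ = refl
varU-concentrated (suc zero)    (suc j) n _ = refl

varV-concentrated : Concentrated 0 1 varV
varV-concentrated zero (suc zero) n (inj₁ 0≢0) = ⊥-elim (0≢0 refl)
varV-concentrated zero (suc zero) n (inj₂ 1≢1) = ⊥-elim (1≢1 refl)
varV-concentrated (suc i) j             n _ = refl
varV-concentrated zero    zero          n _ = refl
varV-concentrated zero    (suc (suc j)) n _ = refl

varU-monomial : IsMonomial 0 1ℚ (varU 1 0)
varU-monomial = refl , λ { zero 0≢0 → ⊥-elim (0≢0 refl) ; (suc m) _ → refl }

varV-monomial : IsMonomial 0 1ℚ (varV 0 1)
varV-monomial = refl , λ { zero 0≢0 → ⊥-elim (0≢0 refl) ; (suc m) _ → refl }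

UV-concentrated : Concentrated 1 1 UV
UV-concentrated = *-concentrated varU-concentrated varV-concentrated

UV-* : ∀ G i j n → (UV *₃ G) (suc i) (suc j) n ≡ G i j n
UV-* G i j n = begin
  (UV *₃ G) (suc i) (suc j) n
    ≡⟨ *-at G UV-concentrated i j n ⟩
  sumUpTo n (λ n₁ → UV 1 1 n₁ * G i j (n ∸ n₁))
    ≡⟨ monomial0-conv UV-monomial (G i j) n ⟩
  1ℚ * G i j n
    ≡⟨ *-identityˡ (G i j n) ⟩
  G i j n  ∎
  where
  UV-profile : ∀ m → UV 1 1 m ≡ varV 0 1 m
  UV-profile m = trans (*-at varV varU-concentrated 0 1 m)
                       (trans (monomial0-conv varU-monomial (varV 0 1) m) (*-identityˡ (varV 0 1 m)))
  UV-monomial : IsMonomial 0 1ℚ (UV 1 1)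
  UV-monomial = trans (UV-profile 0) (proj₁ varV-monomial)
              , λ m m≢0 → trans (UV-profile m) (proj₂ varV-monomial m m≢0)

one-* : ∀ G i j n → (one₃ *₃ G) i j n ≡ G i j n
one-* G i j n = trans (const-* 1ℚ G i j n) (*-identityˡ (G i j n))

varX-concentrated : Concentrated 0 0 varX
varX-concentrated zero    zero    n (inj₁ 0≢0) = ⊥-elim (0≢0 refl)
varX-concentrated zero    zero    n (inj₂ 0≢0) = ⊥-elim (0≢0 refl)
varX-concentrated zero    (suc j) n _          = refl
varX-concentrated (suc i) j       n _          = refl

varX-profile : ∀ m → varX 0 0 m ≡ powerCoeffℚ 0 1 m
varX-profile zero          = refl
varX-profile (suc zero)    = refl
varX-profile (suc (suc m)) = refl

-- x + x² = x (1+x)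
A : FPS3
A = (varX ^₃ 2) +₃ varX

X¹-concentrated : Concentrated 0 0 (varX ^₃ 1)
X¹-concentrated i j n off = trans (one-* varX i j n) (varX-concentrated i j n off)

X²-concentrated : Concentrated 0 0 (varX ^₃ 2)
X²-concentrated = *-concentrated X¹-concentrated varX-concentrated

X²-profile : ∀ m → (varX ^₃ 2) 0 0 m ≡ powerCoeffℚ 0 2 m
X²-profile m = begin
  (varX ^₃ 2) 0 0 m
    ≡⟨ *-at varX X¹-concentrated 0 0 m ⟩
  sumUpTo m (λ n₁ → (one₃ *₃ varX) 0 0 n₁ * varX 0 0 (m ∸ n₁))
    ≡⟨ sum-cong (suc m) (λ n₁ _ → cong₂ _*_ (trans (one-* varX 0 0 n₁) (varX-profile n₁)) (varX-profile (m ∸ n₁))) ⟩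
  sumUpTo m (λ n₁ → powerCoeffℚ 0 1 n₁ * powerCoeffℚ 0 1 (m ∸ n₁))
    ≡⟨ powerCoeff-conv 0 0 1 1 m ⟩
  powerCoeffℚ 0 2 m  ∎

A-concentrated : Concentrated 0 0 A
A-concentrated i j n off =
  trans (cong₂ _+_ (X²-concentrated i j n off) (varX-concentrated i j n off)) (+-identityˡ 0ℚ)

A-profile : ∀ m → A 0 0 m ≡ powerCoeffℚ 1 1 m
A-profile m = begin
  A 0 0 m                                        ≡⟨ cong₂ _+_ (X²-profile m) (varX-profile m) ⟩
  powerCoeffℚ 0 2 m + powerCoeffℚ 0 1 m          ≡⟨ +-comm (powerCoeffℚ 0 2 m) (powerCoeffℚ 0 1 m) ⟩
  powerCoeffℚ 0 1 m + powerCoeffℚ 0 2 m          ≡⟨ fromℕ-+ (powerCoeff 0 1 m) (powerCoeff 0 2 m) ⟨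
  powerCoeffℚ 1 1 m                              ∎

-- u v (x + x²), whose k-th power is concentrated in bidegree (k, k)
-- with x-profile x^k (1+x)^k.
Q : FPS3
Q = UV *₃ A

Q-concentrated : Concentrated 1 1 Q
Q-concentrated = *-concentrated UV-concentrated A-concentrated

Q-profile : ∀ m → Q 1 1 m ≡ powerCoeffℚ 1 1 m
Q-profile m = trans (UV-* A 0 0 m) (A-profile m)

Qᵏ-concentrated : ∀ k → Concentrated k k (Q ^₃ k)
Qᵏ-concentrated zero    = const-concentrated 1ℚ
Qᵏ-concentrated (suc k) = subst (λ d → Concentrated d d (Q ^₃ suc k)) (ℕP.+-comm k 1)
  (*-concentrated (Qᵏ-concentrated k) Q-concentrated)

Qᵏ-profile : ∀ k m → (Q ^₃ k) k k m ≡ powerCoeffℚ k k m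
Qᵏ-profile zero    zero    = refl
Qᵏ-profile zero    (suc m) = refl
Qᵏ-profile (suc k) m = begin
  (Q ^₃ suc k) (suc k) (suc k) m
    ≡⟨ cong (λ d → (Q ^₃ suc k) d d m) (ℕP.+-comm 1 k) ⟩
  (Q ^₃ k *₃ Q) (k ℕ.+ 1) (k ℕ.+ 1) m
    ≡⟨ *-at Q (Qᵏ-concentrated k) 1 1 m ⟩
  sumUpTo m (λ n₁ → (Q ^₃ k) k k n₁ * Q 1 1 (m ∸ n₁))
    ≡⟨ sum-cong (suc m) (λ n₁ _ → cong₂ _*_ (Qᵏ-profile k n₁) (Q-profile (m ∸ n₁))) ⟩
  sumUpTo m (λ n₁ → powerCoeffℚ k k n₁ * powerCoeffℚ 1 1 (m ∸ n₁))
    ≡⟨ powerCoeff-conv k 1 k 1 m ⟩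
  powerCoeffℚ (k ℕ.+ 1) (k ℕ.+ 1) m
    ≡⟨ cong (λ d → powerCoeffℚ d d m) (ℕP.+-comm k 1) ⟩
  powerCoeffℚ (suc k) (suc k) m  ∎

module Summand (k : ℕ) where

  c : ℚ
  c = inv! k * inv! k

  U V : FPS3
  U = substUX (psi k)
  V = substVX (psi k)

  T₁ T₂ : FPS3
  T₁ = const₃ c *₃ (Q ^₃ k)
  T₂ = T₁ *₃ U

  U-monomial : ∀ a → IsMonomial a (psi k a) (U a 0)
  U-monomial a = value , off
    where
    value : U a 0 a ≡ psi k a
    value rewrite ≡ᵇ-refl a = refl
    off : ∀ m → m ≢ a → U a 0 m ≡ 0ℚ
    off m m≢a rewrite ≢⇒≡ᵇ-false a m (≢-sym m≢a) = refl

  V-monomial : ∀ b → IsMonomial b (psi k b) (V 0 b)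
  V-monomial b = value , off
    where
    value : V 0 b b ≡ psi k b
    value rewrite ≡ᵇ-refl b = refl
    off : ∀ m → m ≢ b → V 0 b m ≡ 0ℚ
    off m m≢b rewrite ≢⇒≡ᵇ-false b m (≢-sym m≢b) = refl

  V-offU : ∀ i j n → i ≢ 0 → V i j n ≡ 0ℚ
  V-offU zero    j n 0≢0 = ⊥-elim (0≢0 refl)
  V-offU (suc i) j n _   = refl

  T₁-concentrated : Concentrated k k T₁
  T₁-concentrated i j n off = trans (const-* c (Q ^₃ k) i j n) (factorʳ-zero {c} (Qᵏ-concentrated k i j n off))

  T₁-profile : ∀ m → T₁ k k m ≡ c * powerCoeffℚ k k m
  T₁-profile m = trans (const-* c (Q ^₃ k) k k m) (cong (c *_) (Qᵏ-profile k m))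

  U-offV : ∀ i j n → j ≢ 0 → U i j n ≡ 0ℚ
  U-offV i zero    n 0≢0 = ⊥-elim (0≢0 refl)
  U-offV i (suc j) n _   = refl

  T₂-offV : ∀ i j n → j ≢ k → T₂ i j n ≡ 0ℚ
  T₂-offV = *-offV T₁-concentrated U-offV

  T₂-profile : ∀ a m → T₂ (k ℕ.+ a) k m ≡ c * powerCoeffℚ k (k ℕ.+ a) m * psi k a
  T₂-profile a m = begin
    T₂ (k ℕ.+ a) k m
      ≡⟨ cong (λ j → T₂ (k ℕ.+ a) j m) (ℕP.+-identityʳ k) ⟨
    T₂ (k ℕ.+ a) (k ℕ.+ 0) m
      ≡⟨ *-at U T₁-concentrated a 0 m ⟩
    sumUpTo m (λ n₁ → T₁ k k n₁ * U a 0 (m ∸ n₁))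
      ≡⟨ sum-cong (suc m) (λ n₁ _ → cong (_* U a 0 (m ∸ n₁)) (T₁-profile n₁)) ⟩
    sumUpTo m (λ n₁ → c * powerCoeffℚ k k n₁ * U a 0 (m ∸ n₁))
      ≡⟨ kernel-conv (scaleˡ (powerCoeff-kernel k) c) (U-monomial a) k m ⟩
    c * powerCoeffℚ k (k ℕ.+ a) m * psi k a  ∎

  summand-vanishesBelow : VanishesBelow k k (term k)
  summand-vanishesBelow = *-vanishesBelow V (*-vanishesBelow U (concentrated⇒vanishesBelow T₁-concentrated))

  summand-profile : ∀ a b n →
    term k (k ℕ.+ a) (k ℕ.+ b) n ≡ c * powerCoeffℚ k (k ℕ.+ a ℕ.+ b) n * psi k a * psi k b
  summand-profile a b n = begin
    (T₂ *₃ V) (k ℕ.+ a) (k ℕ.+ b) n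
      ≡⟨ *-atʳ T₂-offV V-offU (k ℕ.+ a) b n ⟩
    sumUpTo n (λ n₁ → T₂ (k ℕ.+ a) k n₁ * V 0 b (n ∸ n₁))
      ≡⟨ sum-cong (suc n) (λ n₁ _ → cong (_* V 0 b (n ∸ n₁)) (T₂-profile a n₁)) ⟩
    sumUpTo n (λ n₁ → c * powerCoeffℚ k (k ℕ.+ a) n₁ * psi k a * V 0 b (n ∸ n₁))
      ≡⟨ kernel-conv (scaleʳ (scaleˡ (powerCoeff-kernel k) c) (psi k a)) (V-monomial b) (k ℕ.+ a) n ⟩
    c * powerCoeffℚ k (k ℕ.+ a ℕ.+ b) n * psi k a * psi k b  ∎

delannoyTerm-vanishes : ∀ a b n k → (a < k ⊎ b < k) → delannoyTerm a b n k ≡ 0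
delannoyTerm-vanishes a b n k (inj₁ a<k) =
  cong (λ x → x ℕ.* (b C k) ℕ.* powerCoeff k (a ℕ.+ b) (n ℕ.+ k)) (k>n⇒nCk≡0 a<k)
delannoyTerm-vanishes a b n k (inj₂ b<k) = trans
  (cong (λ x → (a C k) ℕ.* x ℕ.* powerCoeff k (a ℕ.+ b) (n ℕ.+ k)) (k>n⇒nCk≡0 b<k))
  (cong (ℕ._* powerCoeff k (a ℕ.+ b) (n ℕ.+ k)) (ℕP.*-zeroʳ (a C k)))

summand-closed-at : ∀ k a b n → term k (k ℕ.+ a) (k ℕ.+ b) n ≡
  fromℕ (delannoyTerm (k ℕ.+ a) (k ℕ.+ b) n k) * (inv! (suc (k ℕ.+ a)) * inv! (suc (k ℕ.+ b)))
summand-closed-at k a b n = begin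
  term k (k ℕ.+ a) (k ℕ.+ b) n
    ≡⟨ Summand.summand-profile k a b n ⟩
  I * I * E * psi k a * psi k b
    ≡⟨ cong₂ (λ ψa ψb → I * I * E * ψa * ψb) (psi-closed k a) (psi-closed k b) ⟩
  I * I * E * (F * Bₐ * Xₐ) * (F * B_b * X_b)
    ≡⟨ regroup I F Bₐ B_b E Xₐ X_b ⟩
  (F * I) * (F * I) * (Bₐ * B_b * E * (Xₐ * X_b))
    ≡⟨ cong (λ one → one * one * (Bₐ * B_b * E * (Xₐ * X_b))) (fromℕ-!-inv! k) ⟩
  1ℚ * 1ℚ * (Bₐ * B_b * E * (Xₐ * X_b))
    ≡⟨ *-identityˡ (Bₐ * B_b * E * (Xₐ * X_b)) ⟩
  Bₐ * B_b * E * (Xₐ * X_b)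
    ≡⟨ cong (λ B → B * E * (Xₐ * X_b)) (fromℕ-* Cₐ C_b) ⟨
  fromℕ (Cₐ ℕ.* C_b) * E * (Xₐ * X_b)
    ≡⟨ cong (λ e → fromℕ (Cₐ ℕ.* C_b) * fromℕ e * (Xₐ * X_b)) shifted ⟨
  fromℕ (Cₐ ℕ.* C_b) * fromℕ (powerCoeff k (k ℕ.+ a ℕ.+ (k ℕ.+ b)) (n ℕ.+ k)) * (Xₐ * X_b)
    ≡⟨ cong (_* (Xₐ * X_b)) (fromℕ-* (Cₐ ℕ.* C_b) (powerCoeff k (k ℕ.+ a ℕ.+ (k ℕ.+ b)) (n ℕ.+ k))) ⟨
  fromℕ (delannoyTerm (k ℕ.+ a) (k ℕ.+ b) n k) * (Xₐ * X_b)  ∎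
  where
  open ℚSolver.+-*-Solver
  I = inv! k
  F = fromℕ (k !)
  Cₐ = (k ℕ.+ a) C k
  C_b = (k ℕ.+ b) C k
  Bₐ = fromℕ Cₐ
  B_b = fromℕ C_b
  E = powerCoeffℚ k (k ℕ.+ a ℕ.+ b) n
  Xₐ = inv! (suc (k ℕ.+ a))
  X_b = inv! (suc (k ℕ.+ b))
  regroup : ∀ I F Bₐ B_b E Xₐ X_b →
    I * I * E * (F * Bₐ * Xₐ) * (F * B_b * X_b) ≡ (F * I) * (F * I) * (Bₐ * B_b * E * (Xₐ * X_b))
  regroup = solve 7 (λ I F Bₐ B_b E Xₐ X_b →
    I :* I :* E :* (F :* Bₐ :* Xₐ) :* (F :* B_b :* X_b) := (F :* I) :* (F :* I) :* (Bₐ :* B_b :* E :* (Xₐ :* X_b))) refl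
  shifted : powerCoeff k (k ℕ.+ a ℕ.+ (k ℕ.+ b)) (n ℕ.+ k) ≡ powerCoeff k (k ℕ.+ a ℕ.+ b) n
  shifted = trans (cong (λ s → powerCoeff k s (n ℕ.+ k)) exponents) (powerCoeff-shift+ k (k ℕ.+ a ℕ.+ b) n k)
    where
    exponents : k ℕ.+ a ℕ.+ (k ℕ.+ b) ≡ k ℕ.+ a ℕ.+ b ℕ.+ k
    exponents = trans (cong (k ℕ.+ a ℕ.+_) (ℕP.+-comm k b)) (sym (ℕP.+-assoc (k ℕ.+ a) b k))

summand-closed : ∀ k a b n → term k a b n ≡ fromℕ (delannoyTerm a b n k) * (inv! (suc a) * inv! (suc b))
summand-closed k = agree-above (term k) closed (Summand.summand-vanishesBelow k) closed-below (summand-closed-at k)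
  where
  closed : ℕ → ℕ → ℕ → ℚ
  closed a b n = fromℕ (delannoyTerm a b n k) * (inv! (suc a) * inv! (suc b))
  closed-below : ∀ a b n → (a < k ⊎ b < k) → closed a b n ≡ 0ℚ
  closed-below a b n below = factorˡ-zero (cong fromℕ (delannoyTerm-vanishes a b n k below))

-- The sum of all summands; only k ≤ i contribute to [u^i v^j xⁿ].
S : FPS3
S i j n = sumUpTo i (λ k → term k i j n)

S-hasSum : HasSum term S
S-hasSum i j n = suc i , sum-stable (suc i) (λ k i<k → Summand.summand-vanishesBelow k i j n (inj₁ i<k))

S-closed : ∀ a b n → S a b n ≡ fromℕ (delannoyCoeff a b n) * (inv! (suc a) * inv! (suc b))
S-closed a b n = begin
  sumUpTo a (λ k → term k a b n)
    ≡⟨ sum-cong (suc a) (λ k _ → summand-closed k a b n) ⟩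
  sumUpTo a (λ k → fromℕ (delannoyTerm a b n k) * (inv! (suc a) * inv! (suc b)))
    ≡⟨ sum-*ʳ (suc a) (λ k → fromℕ (delannoyTerm a b n k)) _ ⟩
  sumUpTo a (λ k → fromℕ (delannoyTerm a b n k)) * (inv! (suc a) * inv! (suc b))
    ≡⟨ cong (_* (inv! (suc a) * inv! (suc b))) (trans (sym (fromℕ-sum (suc a) (delannoyTerm a b n)))
                                                       (cong fromℕ (sym (delannoy-closed n a b)))) ⟩
  fromℕ (delannoyCoeff a b n) * (inv! (suc a) * inv! (suc b))  ∎

Dtilde-UV-S : ∀ i j n → Dtilde i j n ≡ (UV *₃ S) i j n
Dtilde-UV-S zero    j       n = sym (UV-S-vanishesBelow 0 j n (inj₁ (s≤s z≤n)))
  where UV-S-vanishesBelow = *-vanishesBelow S (concentrated⇒vanishesBelow UV-concentrated)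
Dtilde-UV-S (suc a) zero    n = sym (UV-S-vanishesBelow (suc a) 0 n (inj₂ (s≤s z≤n)))
  where UV-S-vanishesBelow = *-vanishesBelow S (concentrated⇒vanishesBelow UV-concentrated)
Dtilde-UV-S (suc a) (suc b) n = begin
  fromℕ (delannoyCoeff a b n) * inv! (suc a) * inv! (suc b)
    ≡⟨ *-assoc (fromℕ (delannoyCoeff a b n)) (inv! (suc a)) (inv! (suc b)) ⟩
  fromℕ (delannoyCoeff a b n) * (inv! (suc a) * inv! (suc b))
    ≡⟨ S-closed a b n ⟨
  S a b n
    ≡⟨ UV-* S a b n ⟨
  (UV *₃ S) (suc a) (suc b) n  ∎

theorem8p4 : Σ FPS3 λ S → HasSum term S ×
    (∀ i j n → Dtilde i j n ≡ (varU *₃ varV *₃ S) i j n)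
theorem8p4 = S , S-hasSum , Dtilde-UV-S
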